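{- Let $p=(p_i)_{i=1}^n$, $q=(q_i)_{i=1}^n$ be lattice paths with $p\preceq q$ such that the strong lattice path matroid $M=M[p,q]$ on $E=\{1,\ldots,n\}$ has no loops. Let $j\in E$ with $q_j=\mathrm{N}$. Then $\{1,2,\ldots,j-1\}=\operatorname{cl}_M(\{1,2,\ldots,j-1\})$, and for every $k\in E$ with $k\ge j$, $\operatorname{rk}_M(\{1,\ldots,j-1\}\cup\{k\})=\operatorname{rk}_M(\{1,\ldots,j-1\})+1$.
   Context: A lattice path of length $n$ is a tuple $(r_i)_{i=1}^n\in\{\mathrm{N},\mathrm{E}\}^n$. For lattice paths $p,q$ of length $n$, we write $p\preceq q$ if for all $k$, $|\{i\le k\mid p_i=\mathrm{N}\}|\le|\{i\le k\mid q_i=\mathrm{N}\}|$, with equality for $k=n$. $\mathrm{P}[p,q]=\{r\mid p\preceq r\preceq q\}$. For $p\preceq q$, the strong lattice path matroid $M[p,q]$ is the transversal matroid on $\{1,\ldots,n\}$ presented by the family $(A_i)_{i=1}^m$, $m=|\{i\mid q_i=\mathrm{N}\}|$, where $A_i$ is the set of $j$ such that some $r\in\mathrm{P}[p,q]$ has $r_j=\mathrm{N}$ and $|\{k\le j\mid r_k=\mathrm{N}\}|=i$. (Its bases are exactly the sets $\{j\mid r_j=\mathrm{N}\}$ for $r\in\mathrm{P}[p,q]$.) -}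

module Defs where

open import Data.Nat using (ℕ; zero; suc; _+_; _≤_; _<_; _<ᵇ_)
open import Data.Fin using (Fin; toℕ)
open import Data.Fin.Subset using (Subset; _∈_; _∉_; _⊆_; ∣_∣; _∪_; ⁅_⁆)
open import Data.Vec using (Vec; lookup; tabulate)
open import Data.Product using (Σ; _×_; ∃)
open import Relation.Binary.PropositionalEquality using (_≡_)

data Step : Set where
  N E : Step

-- A lattice path of length n.  Positions are 0-indexed: Fin n index i
-- corresponds to the paper's position i+1.
Path : ℕ → Set
Path n = Vec Step n

isN : Step → ℕ
isN N = 1
isN E = 0

-- #N p k = |{ i ≤ k | p_i = N }| in the paper's 1-indexed convention,
-- i.e. number of N steps among the first k steps.
#N : ∀ {n} → Path n → ℕ → ℕ
#N {zero} _ _ = 0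
#N {suc n} _ zero = 0
#N {suc n} (s Vec.∷ p) (suc k) = isN s + #N p k

_⪯_ : ∀ {n} → Path n → Path n → Set
_⪯_ {n} p q = (∀ k → k ≤ n → #N p k ≤ #N q k) × (#N p n ≡ #N q n)

InInterval : ∀ {n} → Path n → Path n → Path n → Set
InInterval p q r = (p ⪯ r) × (r ⪯ q)

height : ∀ {n} → Path n → ℕ
height {n} q = #N q n

InA : ∀ {n} → Path n → Path n → ℕ → Fin n → Set
InA p q i j = ∃ λ r → InInterval p q r × (lookup r j ≡ N) × (#N r (suc (toℕ j)) ≡ i)

-- Independent sets of the transversal matroid M[p,q] presented by
-- (A_i)_{i=1}^m: the partial transversals, i.e. sets X admitting an
-- injective assignment φ : X → {1..m} with x ∈ A_{φ x}.
Independent : ∀ {n} → Path n → Path n → Subset n → Set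
Independent {n} p q X =
  Σ (Fin n → ℕ) λ φ →
    (∀ x → x ∈ X → (1 ≤ φ x) × (φ x ≤ height q) × InA p q (φ x) x)
    × (∀ x y → x ∈ X → y ∈ X → φ x ≡ φ y → x ≡ y)

IsRank : ∀ {n} → Path n → Path n → Subset n → ℕ → Set
IsRank p q X r =
  (∃ λ Y → Y ⊆ X × Independent p q Y × ∣ Y ∣ ≡ r)
  × (∀ Y → Y ⊆ X → Independent p q Y → ∣ Y ∣ ≤ r)

InClosure : ∀ {n} → Path n → Path n → Subset n → Fin n → Set
InClosure p q X e = ∀ r r' → IsRank p q X r → IsRank p q (X ∪ ⁅ e ⁆) r' → r ≡ r'

Loopless : ∀ {n} → Path n → Path n → Set
Loopless {n} p q = ∀ (e : Fin n) → Independent p q ⁅ e ⁆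

-- The set of positions strictly before j (paper: {1,…,j-1} for paper-index j).
before : ∀ {n} → Fin n → Subset n
before j = tabulate (λ i → toℕ i <ᵇ toℕ j)

module Submission where

-- Write X = before j and c = #N q j, the number of N steps of q strictly
-- before position j.
--
-- (1) rk X = c, for every j.  The N-positions of q before j are independent,
--     each labelled by the height of q after it.  Conversely an element x of
--     an independent set can only carry a label i ≤ #N q (x+1), because the
--     witnessing path lies below q; inside X all labels are thus ≤ c, and the
--     pigeonhole principle bounds the size by c.
-- (2) rk (X ∪ {k}) = c + 1 when q_j = N and k ≥ j.  Adding an element raises
--     a rank by at most one.  For the lower bound, looplessness gives a path
--     s ∈ P[p,q] with s_k = N; the path r whose count function is
--     max (#N s) (min (#N q) (c + [t > k])) still lies in P[p,q], still has
--     r_k = N, and reaches height c + 1 at k, so k labelled by that height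
--     extends the independent set of (1).  This uses that count functions of
--     paths are exactly the functions with unit steps, a class closed under
--     max and min.
-- (3) Elements of X lie in its closure; any other e has e ≥ j, so by (2) and
--     (1) adding it raises the rank: X is closed.

open import Defs
open import Data.Nat using (>-nonZero; ℕ; zero; suc; _≤_; _<_; _+_; _⊔_; _⊓_; _≤′_; ≤′-refl; ≤′-step; pred; _<ᵇ_; z≤n; s≤s)
open import Data.Nat.Properties
open import Algebra.Properties.CommutativeSemigroup +-commutativeSemigroup using (x∙yz≈y∙xz)
open import Data.Fin using (Fin; toℕ) renaming (zero to fzero; suc to fsuc)
import Data.Fin as Fin
open import Data.Fin.Properties using (toℕ<n; toℕ-injective) renaming (suc-injective to fsuc-injective)
open import Data.Fin.Subset using (Subset; _∈_; _∉_; _⊆_; _∪_; _-_; ⁅_⁆; ∣_∣; inside; outside) renaming (⊥ to ∅)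
open import Data.Fin.Subset.Properties using (x∈⁅x⁆; x∈⁅y⁆⇒x≡y; x∈p∪q⁻; x∈p∪q⁺; ∉⊥; ∣⊥∣≡0; ∪-identityʳ; p─q⊆p; p─⊥≡p)
open import Data.Vec using ([]; _∷_; lookup; here; there)
open import Data.Vec.Properties using (lookup∘tabulate; []=⇒lookup; lookup⇒[]=)
open import Data.Bool using (T)
open import Data.Bool.Properties using (T-≡)
open import Data.Unit using (tt)
open import Data.Empty using (⊥-elim)
open import Data.Product using (_×_; _,_; proj₁; proj₂; ∃)
open import Data.Sum using (inj₁; inj₂)
open import Function using (_∘_)
open import Function.Bundles using (_⇔_; mk⇔; Equivalence)
open import Relation.Nullary using (yes; no; ¬_)
open import Relation.Binary.PropositionalEquality
open import Relation.Binary.Definitions using (tri<; tri≈; tri>)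

UnitSteps : (ℕ → ℕ) → Set
UnitSteps f = ∀ t → f t ≤ f (suc t) × f (suc t) ≤ suc (f t)

unitSteps-mono : ∀ {f} → UnitSteps f → ∀ {a b} → a ≤ b → f a ≤ f b
unitSteps-mono {f} u a≤b = go (≤⇒≤′ a≤b)
  where
    go : ∀ {a b} → a ≤′ b → f a ≤ f b
    go ≤′-refl = ≤-refl
    go (≤′-step a≤′b) = ≤-trans (go a≤′b) (proj₁ (u _))

⊔-unitSteps : ∀ {f g} → UnitSteps f → UnitSteps g → UnitSteps (λ t → f t ⊔ g t)
⊔-unitSteps {f} {g} uf ug t =
  ⊔-mono-≤ (proj₁ (uf t)) (proj₁ (ug t)) ,
  ≤-trans (⊔-mono-≤ (proj₂ (uf t)) (proj₂ (ug t))) (≤-reflexive (sym (+-distribˡ-⊔ 1 (f t) (g t))))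

⊓-unitSteps : ∀ {f g} → UnitSteps f → UnitSteps g → UnitSteps (λ t → f t ⊓ g t)
⊓-unitSteps {f} {g} uf ug t =
  ⊓-mono-≤ (proj₁ (uf t)) (proj₁ (ug t)) ,
  ≤-trans (⊓-mono-≤ (proj₂ (uf t)) (proj₂ (ug t))) (≤-reflexive (sym (+-distribˡ-⊓ 1 (f t) (g t))))

+-unitSteps : ∀ {f} c → UnitSteps f → UnitSteps (λ t → f t + c)
+-unitSteps c u t = +-monoˡ-≤ c (proj₁ (u t)) , +-monoˡ-≤ c (proj₂ (u t))

-- after k t = 1 if t > k, and 0 otherwise; it lets the raised path of `raise`
-- jump above height c exactly at position k.
after : ℕ → ℕ → ℕ
after k zero = 0
after zero (suc t) = 1
after (suc k) (suc t) = after k t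

after-unitSteps : ∀ k → UnitSteps (after k)
after-unitSteps zero zero = z≤n , ≤-refl
after-unitSteps zero (suc t) = ≤-refl , n≤1+n 1
after-unitSteps (suc k) zero = ≤-refl , z≤n
after-unitSteps (suc k) (suc t) = after-unitSteps k t

after-at : ∀ k → after k k ≡ 0
after-at zero = refl
after-at (suc k) = after-at k

after-past : ∀ k → after k (suc k) ≡ 1
after-past zero = refl
after-past (suc k) = after-past k

#N-zero : ∀ {n} (r : Path n) → #N r 0 ≡ 0
#N-zero {zero} r = refl
#N-zero {suc n} (s ∷ r) = refl

#N-suc : ∀ {n} (r : Path n) (x : Fin n) → #N r (suc (toℕ x)) ≡ isN (lookup r x) + #N r (toℕ x)
#N-suc (s ∷ r) fzero = cong (isN s +_) (#N-zero r)
#N-suc (s ∷ r) (fsuc x) =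
  trans (cong (isN s +_) (#N-suc r x)) (x∙yz≈y∙xz (isN s) (isN (lookup r x)) (#N r (toℕ x)))

#N-at-N : ∀ {n} (r : Path n) (x : Fin n) → lookup r x ≡ N → #N r (suc (toℕ x)) ≡ suc (#N r (toℕ x))
#N-at-N r x rx = trans (#N-suc r x) (cong (λ s → isN s + #N r (toℕ x)) rx)

N-at-#N : ∀ {n} (r : Path n) (x : Fin n) → #N r (suc (toℕ x)) ≡ suc (#N r (toℕ x)) → lookup r x ≡ N
N-at-#N r x grows with lookup r x | #N-suc r x
... | N | _ = refl
... | E | eq = ⊥-elim (1+n≢n (trans (sym grows) eq))

#N-unitSteps : ∀ {n} (r : Path n) → UnitSteps (#N r)
#N-unitSteps {zero} r t = ≤-refl , z≤n
#N-unitSteps {suc n} (N ∷ r) zero = z≤n , s≤s (≤-reflexive (#N-zero r))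
#N-unitSteps {suc n} (E ∷ r) zero = z≤n , ≤-trans (≤-reflexive (#N-zero r)) z≤n
#N-unitSteps {suc n} (s ∷ r) (suc t) =
  +-monoʳ-≤ (isN s) (proj₁ (#N-unitSteps r t)) ,
  ≤-trans (+-monoʳ-≤ (isN s) (proj₂ (#N-unitSteps r t))) (≤-reflexive (+-suc (isN s) _))

#N-mono : ∀ {n} (r : Path n) {a b} → a ≤ b → #N r a ≤ #N r b
#N-mono r = unitSteps-mono (#N-unitSteps r)

#N-injective-on-N : ∀ {n} (r : Path n) x y → lookup r x ≡ N → lookup r y ≡ N →
                    #N r (suc (toℕ x)) ≡ #N r (suc (toℕ y)) → x ≡ y
#N-injective-on-N r x y rx ry eq with <-cmp (toℕ x) (toℕ y)
... | tri≈ _ x≡y _ = toℕ-injective x≡y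
... | tri< x<y _ _ = ⊥-elim (<-irrefl eq (≤-<-trans (#N-mono r x<y) (≤-reflexive (sym (#N-at-N r y ry)))))
... | tri> _ _ y<x = ⊥-elim (<-irrefl (sym eq) (≤-<-trans (#N-mono r y<x) (≤-reflexive (sym (#N-at-N r x rx)))))

-- Conversely every function with unit steps is, up to its value at 0, the
-- count function of a path: step t is N exactly when f increases there.
stepBetween : ℕ → ℕ → Step
stepBetween a b with a <? b
... | yes _ = N
... | no _ = E

stepBetween-count : ∀ a b → a ≤ b → b ≤ suc a → isN (stepBetween a b) + a ≡ b
stepBetween-count a b a≤b b≤1+a with a <? b
... | yes a<b = ≤-antisym a<b b≤1+a
... | no a≮b = ≤-antisym a≤b (≮⇒≥ a≮b)

pathOf : (n : ℕ) → (ℕ → ℕ) → Path n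
pathOf zero f = []
pathOf (suc n) f = stepBetween (f 0) (f 1) ∷ pathOf n (λ t → f (suc t))

pathOf-count : ∀ n f → UnitSteps f → ∀ t → t ≤ n → #N (pathOf n f) t + f 0 ≡ f t
pathOf-count zero f u zero z≤n = refl
pathOf-count (suc n) f u zero _ = refl
pathOf-count (suc n) f u (suc t) (s≤s t≤n) = begin
  i + B + f 0   ≡⟨ +-assoc i B (f 0) ⟩
  i + (B + f 0) ≡⟨ cong (i +_) (+-comm B (f 0)) ⟩
  i + (f 0 + B) ≡⟨ sym (+-assoc i (f 0) B) ⟩
  i + f 0 + B   ≡⟨ cong (_+ B) (stepBetween-count (f 0) (f 1) (proj₁ (u 0)) (proj₂ (u 0))) ⟩
  f 1 + B       ≡⟨ +-comm (f 1) B ⟩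
  B + f 1       ≡⟨ pathOf-count n (λ t → f (suc t)) (λ t → u (suc t)) t t≤n ⟩
  f (suc t)     ∎
  where
    open ≡-Reasoning
    i = isN (stepBetween (f 0) (f 1))
    B = #N (pathOf n (λ t → f (suc t))) t

pathOf-#N : ∀ n f → UnitSteps f → f 0 ≡ 0 → ∀ t → t ≤ n → #N (pathOf n f) t ≡ f t
pathOf-#N n f u f0 t t≤n =
  trans (sym (trans (cong (#N (pathOf n f) t +_) f0) (+-identityʳ _))) (pathOf-count n f u t t≤n)

squeezed-in-interval : ∀ {n} {p q s r : Path n} → InInterval p q s →
  (∀ t → t ≤ n → #N s t ≤ #N r t) → (∀ t → t ≤ n → #N r t ≤ #N q t) → InInterval p q r
squeezed-in-interval {n} {p} {q} {s} {r} ((p≤s , p≡s) , (s≤q , s≡q)) s≤r r≤q =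
  ((λ t t≤n → ≤-trans (p≤s t t≤n) (s≤r t t≤n)) , trans p≡s (sym r≡s)) ,
  (r≤q , trans r≡s s≡q)
  where
    r≡s : #N r n ≡ #N s n
    r≡s = ≤-antisym (≤-trans (r≤q n ≤-refl) (≤-reflexive (sym s≡q))) (s≤r n ≤-refl)

raise : ∀ {n} {p q s : Path n} (k : Fin n) (c : ℕ) → InInterval p q s → lookup s k ≡ N →
        suc c ≤ #N q (suc (toℕ k)) →
        ∃ λ r → InInterval p q r × lookup r k ≡ N × c < #N r (suc (toℕ k))
raise {n} {p} {q} {s} k c s∈P sk c<qk =
  r , squeezed-in-interval s∈P s≤r r≤q , N-at-#N r k r-grows-at-k , c<rk
  where
    K = toℕ k
    R : ℕ → ℕ
    R t = #N s t ⊔ (#N q t ⊓ (after K t + c))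

    r : Path n
    r = pathOf n R

    r≡R : ∀ t → t ≤ n → #N r t ≡ R t
    r≡R = pathOf-#N n R
      (⊔-unitSteps (#N-unitSteps s) (⊓-unitSteps (#N-unitSteps q) (+-unitSteps c (after-unitSteps K))))
      (cong₂ _⊔_ (#N-zero s) (cong₂ _⊓_ (#N-zero q) refl))

    s≤r : ∀ t → t ≤ n → #N s t ≤ #N r t
    s≤r t t≤n = ≤-trans (m≤m⊔n _ _) (≤-reflexive (sym (r≡R t t≤n)))

    r≤q : ∀ t → t ≤ n → #N r t ≤ #N q t
    r≤q t t≤n = ≤-trans (≤-reflexive (r≡R t t≤n)) (⊔-lub (proj₁ (proj₂ s∈P) t t≤n) (m⊓n≤m _ _))

    c≤qK : c ≤ #N q K
    c≤qK = ≤-pred (≤-trans c<qk (proj₂ (#N-unitSteps q K)))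

    R-at-k : R K ≡ #N s K ⊔ c
    R-at-k = trans (cong (λ a → #N s K ⊔ (#N q K ⊓ (a + c))) (after-at K))
                   (cong (#N s K ⊔_) (m≥n⇒m⊓n≡n c≤qK))

    R-past-k : R (suc K) ≡ suc (#N s K ⊔ c)
    R-past-k = trans (cong (λ a → #N s (suc K) ⊔ (#N q (suc K) ⊓ (a + c))) (after-past K))
                     (cong₂ _⊔_ (#N-at-N s k sk) (m≥n⇒m⊓n≡n c<qk))

    k<n : suc K ≤ n
    k<n = toℕ<n k

    r-grows-at-k : #N r (suc K) ≡ suc (#N r K)
    r-grows-at-k = trans (r≡R (suc K) k<n)
      (trans R-past-k (cong suc (sym (trans (r≡R K (<⇒≤ k<n)) R-at-k))))

    c<rk : c < #N r (suc K)
    c<rk = subst (c <_) (sym (trans (r≡R (suc K) k<n) R-past-k)) (s≤s (m≤n⊔m _ c))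

InjectiveOn : ∀ {n} → Subset n → (Fin n → ℕ) → Set
InjectiveOn Y φ = ∀ x y → x ∈ Y → y ∈ Y → φ x ≡ φ y → x ≡ y

-- Close the gap left by removing the value v from a range of labels.
squeeze : ℕ → ℕ → ℕ
squeeze v a with a <? v
... | yes _ = a
... | no _ = pred a

-- Reopen the gap at v; a left inverse of squeeze v away from v.
expand : ℕ → ℕ → ℕ
expand v b with b <? v
... | yes _ = b
... | no _ = suc b

above : ∀ {v a} → ¬ a < v → a ≢ v → v < a
above a≮v a≢v = ≤∧≢⇒< (≮⇒≥ a≮v) (λ v≡a → a≢v (sym v≡a))

expand-below : ∀ {v b} → b < v → expand v b ≡ b
expand-below {v} {b} b<v with b <? v
... | yes _ = refl
... | no b≮v = ⊥-elim (b≮v b<v)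

expand-pred : ∀ {v a} → v < a → expand v (pred a) ≡ a
expand-pred {v} {suc a} (s≤s v≤a) with a <? v
... | yes a<v = ⊥-elim (≤⇒≯ v≤a a<v)
... | no _ = refl

expand-squeeze : ∀ {v a} → a ≢ v → expand v (squeeze v a) ≡ a
expand-squeeze {v} {a} a≢v with a <? v
... | yes a<v = expand-below a<v
... | no a≮v = expand-pred (above a≮v a≢v)

squeeze-injective : ∀ {v a b} → a ≢ v → b ≢ v → squeeze v a ≡ squeeze v b → a ≡ b
squeeze-injective {v} a≢v b≢v eq =
  trans (sym (expand-squeeze a≢v)) (trans (cong (expand v) eq) (expand-squeeze b≢v))

squeeze-< : ∀ {v a c} → v < suc c → a < suc c → a ≢ v → squeeze v a < c
squeeze-< {v} {a} v≤c a≤c a≢v with a <? v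
... | yes a<v = <-≤-trans a<v (≤-pred v≤c)
... | no a≮v = pred-< (above a≮v a≢v) a≤c
  where
    pred-< : ∀ {v a c} → v < a → a < suc c → pred a < c
    pred-< {a = suc a} _ (s≤s a<c) = a<c

pigeonhole : ∀ {n} (Y : Subset n) (φ : Fin n → ℕ) c → (∀ x → x ∈ Y → φ x < c) → InjectiveOn Y φ → ∣ Y ∣ ≤ c
pigeonhole [] φ c bound inj = z≤n
pigeonhole (outside ∷ Y) φ c bound inj =
  pigeonhole Y (λ x → φ (fsuc x)) c (λ x h → bound (fsuc x) (there h))
    (λ x y hx hy eq → fsuc-injective (inj _ _ (there hx) (there hy) eq))
pigeonhole (inside ∷ Y) φ zero bound inj = ⊥-elim (n≮0 (bound fzero here))
pigeonhole (inside ∷ Y) φ (suc c) bound inj =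
  s≤s (pigeonhole Y (λ x → squeeze v (φ (fsuc x))) c
        (λ x h → squeeze-< (bound fzero here) (bound (fsuc x) (there h)) (differs x h))
        (λ x y hx hy eq → fsuc-injective (inj _ _ (there hx) (there hy)
          (squeeze-injective (differs x hx) (differs y hy) eq))))
  where
    v = φ fzero
    differs : ∀ x → x ∈ Y → φ (fsuc x) ≢ v
    differs x h eq with inj (fsuc x) fzero (there h) here eq
    ... | ()

∈-before⁻ : ∀ {n} (j x : Fin n) → x ∈ before j → toℕ x < toℕ j
∈-before⁻ j x h = <ᵇ⇒< (toℕ x) (toℕ j)
  (subst T (sym (trans (sym (lookup∘tabulate (λ i → toℕ i <ᵇ toℕ j) x)) ([]=⇒lookup h))) tt)

∈-before⁺ : ∀ {n} (j x : Fin n) → toℕ x < toℕ j → x ∈ before j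
∈-before⁺ j x x<j = lookup⇒[]= x (before j)
  (trans (lookup∘tabulate (λ i → toℕ i <ᵇ toℕ j) x) (Equivalence.to T-≡ (<⇒<ᵇ x<j)))

x∉p-x : ∀ {n} (p : Subset n) (x : Fin n) → x ∉ p - x
x∉p-x (b ∷ p) fzero ()
x∉p-x (b ∷ p) (fsuc x) (there h) = x∉p-x p x h

∣p∣≤1+∣p-x∣ : ∀ {n} (p : Subset n) (x : Fin n) → ∣ p ∣ ≤ suc ∣ p - x ∣
∣p∣≤1+∣p-x∣ (inside ∷ p) fzero = s≤s (≤-reflexive (cong ∣_∣ (sym (p─⊥≡p p))))
∣p∣≤1+∣p-x∣ (outside ∷ p) fzero = ≤-trans (≤-reflexive (cong ∣_∣ (sym (p─⊥≡p p)))) (n≤1+n _)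
∣p∣≤1+∣p-x∣ (inside ∷ p) (fsuc x) = s≤s (∣p∣≤1+∣p-x∣ p x)
∣p∣≤1+∣p-x∣ (outside ∷ p) (fsuc x) = ∣p∣≤1+∣p-x∣ p x

∣p∪⁅x⁆∣ : ∀ {n} (p : Subset n) (x : Fin n) → x ∉ p → ∣ p ∪ ⁅ x ⁆ ∣ ≡ suc ∣ p ∣
∣p∪⁅x⁆∣ (inside ∷ p) fzero x∉p = ⊥-elim (x∉p here)
∣p∪⁅x⁆∣ (outside ∷ p) fzero _ = cong (suc ∘ ∣_∣) (∪-identityʳ p)
∣p∪⁅x⁆∣ (inside ∷ p) (fsuc x) x∉p = cong suc (∣p∪⁅x⁆∣ p x (x∉p ∘ there))
∣p∪⁅x⁆∣ (outside ∷ p) (fsuc x) x∉p = ∣p∪⁅x⁆∣ p x (x∉p ∘ there)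

nPositions : ∀ {n} → Path n → ℕ → Subset n
nPositions [] m = []
nPositions (s ∷ q) zero = ∅
nPositions (N ∷ q) (suc m) = inside ∷ nPositions q m
nPositions (E ∷ q) (suc m) = outside ∷ nPositions q m

∣nPositions∣ : ∀ {n} (q : Path n) m → ∣ nPositions q m ∣ ≡ #N q m
∣nPositions∣ [] m = refl
∣nPositions∣ {suc n} (s ∷ q) zero = ∣⊥∣≡0 (suc n)
∣nPositions∣ (N ∷ q) (suc m) = cong suc (∣nPositions∣ q m)
∣nPositions∣ (E ∷ q) (suc m) = ∣nPositions∣ q m

∈-nPositions : ∀ {n} (q : Path n) m x → x ∈ nPositions q m → toℕ x < m × lookup q x ≡ N
∈-nPositions (s ∷ q) zero x h = ⊥-elim (∉⊥ h)
∈-nPositions (N ∷ q) (suc m) fzero here = s≤s z≤n , refl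
∈-nPositions (N ∷ q) (suc m) (fsuc x) (there h) = let (x<m , qx) = ∈-nPositions q m x h in s≤s x<m , qx
∈-nPositions (E ∷ q) (suc m) (fsuc x) (there h) = let (x<m , qx) = ∈-nPositions q m x h in s≤s x<m , qx

-- A label i of x is witnessed by a path below q, so q has climbed to i by x.
label-bound : ∀ {n} {p q : Path n} {i x} → InA p q i x → i ≤ #N q (suc (toℕ x))
label-bound {x = x} (r , (_ , (r≤q , _)) , _ , height≡i) = subst (_≤ _) height≡i (r≤q (suc (toℕ x)) (toℕ<n x))

-- An independent set sitting where q has height at most c has at most c elements:
-- its labels are injective and lie in {1,…,c}.
independent-≤-height : ∀ {n} {p q : Path n} {Y c} → Independent p q Y →
  (∀ x → x ∈ Y → #N q (suc (toℕ x)) ≤ c) → ∣ Y ∣ ≤ c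
independent-≤-height {Y = Y} {c} (φ , labelled , injective) low =
  pigeonhole Y (pred ∘ φ) c
    (λ x x∈Y → let (1≤φx , _ , x∈A) = labelled x x∈Y in
      pred-< 1≤φx (≤-trans (label-bound x∈A) (low x x∈Y)))
    (λ x y x∈Y y∈Y eq → injective x y x∈Y y∈Y (positive-pred-injective (proj₁ (labelled x x∈Y)) (proj₁ (labelled y y∈Y)) eq))
  where
    pred-< : ∀ {a} → 1 ≤ a → a ≤ c → pred a < c
    pred-< {suc a} _ a<c = a<c
    positive-pred-injective : ∀ {a b} → 1 ≤ a → 1 ≤ b → pred a ≡ pred b → a ≡ b
    positive-pred-injective 1≤a 1≤b = pred-injective {{>-nonZero 1≤a}} {{>-nonZero 1≤b}}

independent-⊆ : ∀ {n} {p q : Path n} {Y Z} → Z ⊆ Y → Independent p q Y → Independent p q Z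
independent-⊆ Z⊆Y (φ , labelled , injective) =
  φ , (λ x x∈Z → labelled x (Z⊆Y x∈Z)) , (λ x y x∈Z y∈Z → injective x y (Z⊆Y x∈Z) (Z⊆Y y∈Z))

nPositions-independent : ∀ {n} {p q : Path n} → p ⪯ q → ∀ m → Independent p q (nPositions q m)
nPositions-independent {n} {p} {q} p⪯q m = height-label , labelled , injective
  where
    height-label : Fin n → ℕ
    height-label x = #N q (suc (toℕ x))
    labelled : ∀ x → x ∈ nPositions q m →
      (1 ≤ height-label x) × (height-label x ≤ height q) × InA p q (height-label x) x
    labelled x h = let qx = proj₂ (∈-nPositions q m x h) in
      subst (1 ≤_) (sym (#N-at-N q x qx)) (s≤s z≤n) , #N-mono q (toℕ<n x) ,
      (q , (p⪯q , ((λ _ _ → ≤-refl) , refl)) , qx , refl)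
    injective : InjectiveOn (nPositions q m) height-label
    injective x y hx hy = #N-injective-on-N q x y (proj₂ (∈-nPositions q m x hx)) (proj₂ (∈-nPositions q m y hy))

extend-independent : ∀ {n} {p q : Path n} {Y k i c} (ind : Independent p q Y) →
  (∀ x → x ∈ Y → proj₁ ind x ≤ c) → InA p q i k → c < i → i ≤ height q →
  Independent p q (Y ∪ ⁅ k ⁆)
extend-independent {n} {p} {q} {Y} {k} {i} {c} (φ , labelled , injective) small k∈A c<i i≤m =
  φ′ , labelled′ , injective′
  where
    φ′ : Fin n → ℕ
    φ′ x with x Fin.≟ k
    ... | yes _ = i
    ... | no _ = φ x
    old : ∀ {x} → x ∈ Y ∪ ⁅ k ⁆ → x ≢ k → x ∈ Y
    old {x} h x≢k with x∈p∪q⁻ Y ⁅ k ⁆ h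
    ... | inj₁ x∈Y = x∈Y
    ... | inj₂ x∈k = ⊥-elim (x≢k (x∈⁅y⁆⇒x≡y k x∈k))
    labelled′ : ∀ x → x ∈ Y ∪ ⁅ k ⁆ → (1 ≤ φ′ x) × (φ′ x ≤ height q) × InA p q (φ′ x) x
    labelled′ x h with x Fin.≟ k
    ... | yes refl = ≤-trans (s≤s z≤n) c<i , i≤m , k∈A
    ... | no x≢k = labelled x (old h x≢k)
    injective′ : InjectiveOn (Y ∪ ⁅ k ⁆) φ′
    injective′ x y hx hy eq with x Fin.≟ k | y Fin.≟ k
    ... | yes x≡k | yes y≡k = trans x≡k (sym y≡k)
    ... | yes _ | no y≢k = ⊥-elim (<-irrefl (sym eq) (≤-<-trans (small y (old hy y≢k)) c<i))
    ... | no x≢k | yes _ = ⊥-elim (<-irrefl eq (≤-<-trans (small x (old hx x≢k)) c<i))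
    ... | no x≢k | no y≢k = injective x y (old hx x≢k) (old hy y≢k) eq

nonloop-path : ∀ {n} {p q : Path n} → Loopless p q → ∀ k →
  ∃ λ s → InInterval p q s × lookup s k ≡ N
nonloop-path loopless k with loopless k
... | (_ , labelled , _) with labelled k (x∈⁅x⁆ k)
... | (_ , _ , s , s∈P , sk , _) = s , s∈P , sk

rank-mono : ∀ {n} {p q : Path n} {X X′ r r′} → X ⊆ X′ → IsRank p q X r → IsRank p q X′ r′ → r ≤ r′
rank-mono X⊆X′ ((Y , Y⊆X , indY , ∣Y∣≡r) , _) (_ , maximal′) =
  subst (_≤ _) ∣Y∣≡r (maximal′ Y (X⊆X′ ∘ Y⊆X) indY)

rank-unique : ∀ {n} {p q : Path n} {X r r′} → IsRank p q X r → IsRank p q X r′ → r ≡ r′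
rank-unique rk rk′ = ≤-antisym (rank-mono (λ h → h) rk rk′) (rank-mono (λ h → h) rk′ rk)

rank-bound-∪⁅⁆ : ∀ {n} {p q : Path n} {X r} e → (∀ Y → Y ⊆ X → Independent p q Y → ∣ Y ∣ ≤ r) →
  ∀ Y → Y ⊆ X ∪ ⁅ e ⁆ → Independent p q Y → ∣ Y ∣ ≤ suc r
rank-bound-∪⁅⁆ {X = X} e bound Y Y⊆X∪e indY =
  ≤-trans (∣p∣≤1+∣p-x∣ Y e) (s≤s (bound (Y - e) Y-e⊆X (independent-⊆ (p─q⊆p Y ⁅ e ⁆) indY)))
  where
    Y-e⊆X : Y - e ⊆ X
    Y-e⊆X {x} h with x∈p∪q⁻ X ⁅ e ⁆ (Y⊆X∪e (p─q⊆p Y ⁅ e ⁆ h))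
    ... | inj₁ x∈X = x∈X
    ... | inj₂ x∈e = ⊥-elim (x∉p-x Y e (subst (_∈ Y - e) (x∈⁅y⁆⇒x≡y e x∈e) h))

rank-before : ∀ {n} {p q : Path n} → p ⪯ q → (j : Fin n) → IsRank p q (before j) (#N q (toℕ j))
rank-before {q = q} p⪯q j =
  (nPositions q (toℕ j) , nPositions⊆before , nPositions-independent p⪯q (toℕ j) , ∣nPositions∣ q (toℕ j)) ,
  (λ Y Y⊆X indY → independent-≤-height indY (λ x x∈Y → #N-mono q (∈-before⁻ j x (Y⊆X x∈Y))))
  where
    nPositions⊆before : nPositions q (toℕ j) ⊆ before j
    nPositions⊆before {x} h = ∈-before⁺ j x (proj₁ (∈-nPositions q (toℕ j) x h))

rank-before-∪⁅⁆ : ∀ {n} {p q : Path n} → p ⪯ q → Loopless p q → (j : Fin n) → lookup q j ≡ N →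
  (k : Fin n) → toℕ j ≤ toℕ k → IsRank p q (before j ∪ ⁅ k ⁆) (suc (#N q (toℕ j)))
rank-before-∪⁅⁆ {n} {p} {q} p⪯q loopless j qj k j≤k =
  (Y ∪ ⁅ k ⁆ , Y∪k⊆X∪k , independent , cardinality) ,
  rank-bound-∪⁅⁆ k (proj₂ (rank-before p⪯q j))
  where
    c = #N q (toℕ j)
    Y = nPositions q (toℕ j)
    s-data = nonloop-path loopless k
    c<qk : suc c ≤ #N q (suc (toℕ k))
    c<qk = subst (_≤ _) (#N-at-N q j qj) (#N-mono q (s≤s j≤k))
    r-data = raise k c (proj₁ (proj₂ s-data)) (proj₂ (proj₂ s-data)) c<qk
    r = proj₁ r-data
    k∈A : InA p q (#N r (suc (toℕ k))) k
    k∈A = r , proj₁ (proj₂ r-data) , proj₁ (proj₂ (proj₂ r-data)) , refl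
    independent : Independent p q (Y ∪ ⁅ k ⁆)
    independent = extend-independent (nPositions-independent p⪯q (toℕ j))
      (λ x x∈Y → #N-mono q (proj₁ (∈-nPositions q (toℕ j) x x∈Y)))
      k∈A (proj₂ (proj₂ (proj₂ r-data))) (≤-trans (label-bound k∈A) (#N-mono q (toℕ<n k)))
    k∉Y : k ∉ Y
    k∉Y h = <⇒≱ (proj₁ (∈-nPositions q (toℕ j) k h)) j≤k
    cardinality : ∣ Y ∪ ⁅ k ⁆ ∣ ≡ suc c
    cardinality = trans (∣p∪⁅x⁆∣ Y k k∉Y) (cong suc (∣nPositions∣ q (toℕ j)))
    Y∪k⊆X∪k : Y ∪ ⁅ k ⁆ ⊆ before j ∪ ⁅ k ⁆
    Y∪k⊆X∪k {x} h with x∈p∪q⁻ Y ⁅ k ⁆ h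
    ... | inj₁ x∈Y = x∈p∪q⁺ (inj₁ (∈-before⁺ j x (proj₁ (∈-nPositions q (toℕ j) x x∈Y))))
    ... | inj₂ x∈k = x∈p∪q⁺ (inj₂ x∈k)

member-in-closure : ∀ {n} {p q : Path n} {X e} → e ∈ X → InClosure p q X e
member-in-closure {X = X} {e} e∈X r r′ rk rk′ =
  ≤-antisym (rank-mono (λ h → x∈p∪q⁺ (inj₁ h)) rk rk′) (rank-mono X∪e⊆X rk′ rk)
  where
    X∪e⊆X : X ∪ ⁅ e ⁆ ⊆ X
    X∪e⊆X {x} h with x∈p∪q⁻ X ⁅ e ⁆ h
    ... | inj₁ x∈X = x∈X
    ... | inj₂ x∈e = subst (_∈ X) (sym (x∈⁅y⁆⇒x≡y e x∈e)) e∈X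

mainTheorem2 : ∀ {n} (p q : Path n) → p ⪯ q → Loopless p q →
    (j : Fin n) → lookup q j ≡ N →
    (∀ (e : Fin n) → (e ∈ before j) ⇔ InClosure p q (before j) e)
    × (∀ (k : Fin n) → toℕ j ≤ toℕ k → ∀ (r r' : ℕ) →
         IsRank p q (before j) r → IsRank p q (before j ∪ ⁅ k ⁆) r' → r' ≡ suc r)
mainTheorem2 p q p⪯q loopless j qj = (λ e → mk⇔ member-in-closure (closed e)) , rank-jumps
  where
    rank-jumps : ∀ k → toℕ j ≤ toℕ k → ∀ r r′ →
      IsRank p q (before j) r → IsRank p q (before j ∪ ⁅ k ⁆) r′ → r′ ≡ suc r
    rank-jumps k j≤k r r′ rk rk′ =
      trans (rank-unique rk′ (rank-before-∪⁅⁆ p⪯q loopless j qj k j≤k))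
            (cong suc (rank-unique (rank-before p⪯q j) rk))
    closed : ∀ e → InClosure p q (before j) e → e ∈ before j
    closed e e∈cl with toℕ e <? toℕ j
    ... | yes e<j = ∈-before⁺ j e e<j
    ... | no e≮j = ⊥-elim (1+n≢n (sym (e∈cl _ _ (rank-before p⪯q j) (rank-before-∪⁅⁆ p⪯q loopless j qj e (≮⇒≥ e≮j)))))
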